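{- Let $n\ge 4$ be even and let $\mathbf{c}_1=\overline{0011}[n]$, $\mathbf{c}_2=101\cdot\overline{0}[n-3]$, $\mathbf{c}_3=\overline{0}[n-3]\cdot 100$, $\mathbf{c}_4=\overline{1100}[n]$, $\mathbf{c}_5=001\cdot\overline{0}[n-3]$, $\mathbf{c}_6=\overline{0}[n-3]\cdot 101$. (i) If $n\equiv 0\pmod 4$, then $|T(\mathbf{c}_i)|=2n-3$ for all $i\in\{1,\ldots,6\}$. (ii) If $n\equiv 2\pmod 4$, then $|T(\mathbf{c}_1)|=|T(\mathbf{c}_3)|=|T(\mathbf{c}_5)|=2n-4$ and $|T(\mathbf{c}_2)|=|T(\mathbf{c}_4)|=|T(\mathbf{c}_6)|=2n-2$.
   Context: For $\mathbf{x}=(x_0,\ldots,x_{n-1})\in\mathbb{F}_2^n$, the derivative is $\partial\mathbf{x}=(x_0+x_1,\ldots,x_{n-2}+x_{n-1})\in\mathbb{F}_2^{n-1}$, with $\partial^0\mathbf{x}=\mathbf{x}$ and $\partial^i\mathbf{x}=\partial(\partial^{i-1}\mathbf{x})$. The Steinhaus triangle is $T(\mathbf{x})=(\mathbf{x},\partial\mathbf{x},\ldots,\partial^{n-1}\mathbf{x})$; $|\mathbf{y}|$ is the number of ones of a binary sequence and $|T(\mathbf{x})|=\sum_{i=0}^{n-1}|\partial^i\mathbf{x}|$. Sequences are written as words; a dot denotes concatenation; $\overline{x_1\cdots x_p}[k]$ is the word of the first $k$ letters of the infinite periodic word $x_1\cdots x_px_1\cdots x_p\cdots$. -}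

module Defs where

open import Data.Bool using (Bool; true; false; _xor_)
open import Data.Nat using (ℕ; zero; suc; _+_; _∸_; _%_)
open import Data.List using (List; []; _∷_; _++_; length; map; upTo)
open import Data.Nat.ListAction using (sum)

-- Binary sequences in F₂ⁿ are lists of Booleans (true = 1, addition = xor).
Word : Set
Word = List Bool

∂ : Word → Word
∂ []           = []
∂ (x ∷ [])     = []
∂ (x ∷ y ∷ xs) = (x xor y) ∷ ∂ (y ∷ xs)

∂^ : ℕ → Word → Word
∂^ zero    x = x
∂^ (suc i) x = ∂ (∂^ i x)

weight : Word → ℕ
weight []          = 0
weight (true ∷ xs)  = suc (weight xs)
weight (false ∷ xs) = weight xs

-- |T(x)| = Σ_{i=0}^{n-1} |∂^i x|, n = length x
triangleWeight : Word → ℕ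
triangleWeight x = sum (map (λ i → weight (∂^ i x)) (upTo (length x)))

periodicAt : Bool → List Bool → ℕ → Bool
periodicAt p₀ ps i = lookupMod (p₀ ∷ ps) (i % suc (length ps))
  where
  lookupMod : List Bool → ℕ → Bool
  lookupMod []       _       = false
  lookupMod (y ∷ ys) zero    = y
  lookupMod (y ∷ ys) (suc j) = lookupMod ys j

periodic : Bool → List Bool → ℕ → Word
periodic p₀ ps k = map (periodicAt p₀ ps) (upTo k)

c₁ c₂ c₃ c₄ c₅ c₆ : ℕ → Word
c₁ n = periodic false (false ∷ true ∷ true ∷ []) n
c₂ n = (true ∷ false ∷ true ∷ []) ++ periodic false [] (n ∸ 3)
c₃ n = periodic false [] (n ∸ 3) ++ (true ∷ false ∷ false ∷ [])
c₄ n = periodic true (true ∷ false ∷ false ∷ []) n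
c₅ n = (false ∷ false ∷ true ∷ []) ++ periodic false [] (n ∸ 3)
c₆ n = periodic false [] (n ∸ 3) ++ (true ∷ false ∷ true ∷ [])

-- Each of the six words lies in a family whose Steinhaus triangle is 4-periodic in the length.
-- For c₁ = 0011… and c₄ = 1100… the rows are periodic words with periods 0011 (resp. 1100),
-- 0101 and 1111, after which all rows vanish; adding four letters therefore adds one period
-- to each of the three non-zero rows, i.e. 2 + 2 + 4 = 8 ones.  For c₂ and c₅ every row has
-- the shape a b 1 0…0, and (a, b) runs through a 4-cycle of total weight 8.  Finally c₃ and
-- c₆ are the reversals of c₅ and c₂, and reversal commutes with ∂.  So |T| grows by exactly
-- 8 when the length grows by 4, and the formulas follow from the values at lengths 4 and 6.
module Submission where

open import Data.Bool using (Bool; true; false; _xor_)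
open import Data.Bool.Properties using (xor-comm)
open import Data.List using ([]; _∷_; _++_; _∷ʳ_; length; map; upTo; applyUpTo; replicate; reverse)
open import Data.List.Properties
  using (map-upTo; map-applyUpTo; map-cong; unfold-reverse; reverse-++; length-reverse)
open import Data.Nat using (ℕ; zero; suc; _+_; _*_; _∸_; _%_; _/_; _≤_; s≤s)
open import Data.Nat.DivMod using (m≡m%n+[m/n]*n; m%n<n)
open import Data.Nat.ListAction using (sum)
open import Data.Nat.Properties
  using (+-comm; +-assoc; +-identityʳ; ≤-trans; m≤m+n; m≤n+m; <⇒≱; m+n∸n≡m; +-commutativeSemigroup)
open import Data.Nat.Tactic.RingSolver using (solve-∀)
open import Algebra.Properties.CommutativeSemigroup +-commutativeSemigroup using (interchange; x∙yz≈y∙xz)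
open import Data.Product using (_×_; _,_; ∃-syntax)
open import Data.Empty using (⊥-elim)
open import Function using (_∘_)
open import Relation.Binary.PropositionalEquality using (_≡_; refl; sym; trans; cong; cong₂; subst; module ≡-Reasoning)

open import Defs

open ≡-Reasoning

∂^-suc : ∀ i x → ∂^ (suc i) x ≡ ∂^ i (∂ x)
∂^-suc zero    x = refl
∂^-suc (suc i) x = cong ∂ (∂^-suc i x)

length-∂-∷ : ∀ a xs → length (∂ (a ∷ xs)) ≡ length xs
length-∂-∷ a []       = refl
length-∂-∷ a (b ∷ xs) = cong suc (length-∂-∷ b xs)

triangleWeight-∂ : ∀ x → triangleWeight x ≡ weight x + triangleWeight (∂ x)
triangleWeight-∂ []       = refl
triangleWeight-∂ (a ∷ xs) = cong (weight (a ∷ xs) +_) (begin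
  sum (map row (applyUpTo suc (length xs)))       ≡⟨ cong sum (map-applyUpTo suc row (length xs)) ⟩
  sum (applyUpTo (row ∘ suc) (length xs))         ≡⟨ cong sum (map-upTo (row ∘ suc) (length xs)) ⟨
  sum (map (row ∘ suc) (upTo (length xs)))        ≡⟨ cong sum (map-cong (cong weight ∘ (λ i → ∂^-suc i (a ∷ xs))) (upTo (length xs))) ⟩
  sum (map row′ (upTo (length xs)))               ≡⟨ cong (sum ∘ map row′ ∘ upTo) (length-∂-∷ a xs) ⟨
  triangleWeight (∂ (a ∷ xs))                     ∎)
  where
  row row′ : ℕ → ℕ
  row  i = weight (∂^ i (a ∷ xs))
  row′ i = weight (∂^ i (∂ (a ∷ xs)))

weight-++ : ∀ xs ys → weight (xs ++ ys) ≡ weight xs + weight ys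
weight-++ []           ys = refl
weight-++ (true ∷ xs)  ys = cong suc (weight-++ xs ys)
weight-++ (false ∷ xs) ys = weight-++ xs ys

weight-replicate-false : ∀ k → weight (replicate k false) ≡ 0
weight-replicate-false zero    = refl
weight-replicate-false (suc k) = weight-replicate-false k

∂-replicate-false : ∀ k → ∂ (replicate (suc k) false) ≡ replicate k false
∂-replicate-false zero    = refl
∂-replicate-false (suc k) = cong (false ∷_) (∂-replicate-false k)

triangleWeight-replicate-false : ∀ k → triangleWeight (replicate k false) ≡ 0
triangleWeight-replicate-false zero    = refl
triangleWeight-replicate-false (suc k) = begin
  triangleWeight (replicate (suc k) false)                      ≡⟨ triangleWeight-∂ (replicate (suc k) false) ⟩
  weight (replicate k false) + triangleWeight (∂ (replicate (suc k) false))
    ≡⟨ cong₂ _+_ (weight-replicate-false k) (trans (cong triangleWeight (∂-replicate-false k)) (triangleWeight-replicate-false k)) ⟩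
  0                                                             ∎

∂-∷ʳ-∷ʳ : ∀ xs a b → ∂ ((xs ∷ʳ a) ∷ʳ b) ≡ ∂ (xs ∷ʳ a) ∷ʳ (a xor b)
∂-∷ʳ-∷ʳ []           a b = refl
∂-∷ʳ-∷ʳ (x ∷ [])     a b = refl
∂-∷ʳ-∷ʳ (x ∷ y ∷ xs) a b = cong ((x xor y) ∷_) (∂-∷ʳ-∷ʳ (y ∷ xs) a b)

∂-reverse : ∀ xs → ∂ (reverse xs) ≡ reverse (∂ xs)
∂-reverse []           = refl
∂-reverse (a ∷ [])     = refl
∂-reverse (a ∷ b ∷ xs) = begin
  ∂ (reverse (a ∷ b ∷ xs))            ≡⟨ cong ∂ (trans (unfold-reverse a (b ∷ xs)) (cong (_∷ʳ a) (unfold-reverse b xs))) ⟩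
  ∂ ((reverse xs ∷ʳ b) ∷ʳ a)          ≡⟨ ∂-∷ʳ-∷ʳ (reverse xs) b a ⟩
  ∂ (reverse xs ∷ʳ b) ∷ʳ (b xor a)    ≡⟨ cong₂ _∷ʳ_ (cong ∂ (unfold-reverse b xs)) (xor-comm a b) ⟨
  ∂ (reverse (b ∷ xs)) ∷ʳ (a xor b)   ≡⟨ cong (_∷ʳ (a xor b)) (∂-reverse (b ∷ xs)) ⟩
  reverse (∂ (b ∷ xs)) ∷ʳ (a xor b)   ≡⟨ unfold-reverse (a xor b) (∂ (b ∷ xs)) ⟨
  reverse (∂ (a ∷ b ∷ xs))            ∎

∂^-reverse : ∀ i xs → ∂^ i (reverse xs) ≡ reverse (∂^ i xs)
∂^-reverse zero    xs = refl
∂^-reverse (suc i) xs = trans (cong ∂ (∂^-reverse i xs)) (∂-reverse (∂^ i xs))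

weight-reverse : ∀ xs → weight (reverse xs) ≡ weight xs
weight-reverse []       = refl
weight-reverse (a ∷ xs) = begin
  weight (reverse (a ∷ xs))            ≡⟨ cong weight (unfold-reverse a xs) ⟩
  weight (reverse xs ∷ʳ a)             ≡⟨ weight-++ (reverse xs) (a ∷ []) ⟩
  weight (reverse xs) + weight (a ∷ []) ≡⟨ cong (_+ weight (a ∷ [])) (weight-reverse xs) ⟩
  weight xs + weight (a ∷ [])          ≡⟨ +-comm (weight xs) _ ⟩
  weight (a ∷ []) + weight xs          ≡⟨ weight-++ (a ∷ []) xs ⟨
  weight (a ∷ xs)                      ∎

triangleWeight-reverse : ∀ xs → triangleWeight (reverse xs) ≡ triangleWeight xs
triangleWeight-reverse xs = begin
  sum (map (λ i → weight (∂^ i (reverse xs))) (upTo (length (reverse xs))))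
    ≡⟨ cong (sum ∘ map (λ i → weight (∂^ i (reverse xs))) ∘ upTo) (length-reverse xs) ⟩
  sum (map (λ i → weight (∂^ i (reverse xs))) (upTo (length xs)))
    ≡⟨ cong sum (map-cong (λ i → trans (cong weight (∂^-reverse i xs)) (weight-reverse (∂^ i xs))) (upTo (length xs))) ⟩
  triangleWeight xs ∎

replicate-∷ʳ : ∀ {A : Set} k (x : A) → replicate k x ∷ʳ x ≡ x ∷ replicate k x
replicate-∷ʳ zero    x = refl
replicate-∷ʳ (suc k) x = cong (x ∷_) (replicate-∷ʳ k x)

reverse-replicate : ∀ {A : Set} k (x : A) → reverse (replicate k x) ≡ replicate k x
reverse-replicate zero    x = refl
reverse-replicate (suc k) x = begin
  reverse (x ∷ replicate k x)  ≡⟨ unfold-reverse x (replicate k x) ⟩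
  reverse (replicate k x) ∷ʳ x ≡⟨ cong (_∷ʳ x) (reverse-replicate k x) ⟩
  replicate k x ∷ʳ x           ≡⟨ replicate-∷ʳ k x ⟩
  x ∷ replicate k x            ∎

cycle : Bool → Bool → Bool → Bool → ℕ → Word
cycle a b c d zero    = []
cycle a b c d (suc k) = a ∷ cycle b c d a k

applyUpTo-period4 : ∀ (f : ℕ → Bool) → (∀ i → f (4 + i) ≡ f i) →
                    ∀ k → applyUpTo f k ≡ cycle (f 0) (f 1) (f 2) (f 3) k
applyUpTo-period4 f f-periodic zero    = refl
applyUpTo-period4 f f-periodic (suc k) = cong (f 0 ∷_) (begin
  applyUpTo (f ∘ suc) k                 ≡⟨ applyUpTo-period4 (f ∘ suc) (f-periodic ∘ suc) k ⟩
  cycle (f 1) (f 2) (f 3) (f 4) k       ≡⟨ cong (λ x → cycle (f 1) (f 2) (f 3) x k) (f-periodic 0) ⟩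
  cycle (f 1) (f 2) (f 3) (f 0) k       ∎)

-- periodicAt reduces (4 + i) to i because _%_ is computed by counting down.
periodic-cycle : ∀ a b c d k → periodic a (b ∷ c ∷ d ∷ []) k ≡ cycle a b c d k
periodic-cycle a b c d k = trans (map-upTo _ k) (applyUpTo-period4 _ (λ _ → refl) k)

cycle-false : ∀ k → cycle false false false false k ≡ replicate k false
cycle-false zero    = refl
cycle-false (suc k) = cong (false ∷_) (cycle-false k)

periodic-false : ∀ k → periodic false [] k ≡ replicate k false
periodic-false k = trans (trans (map-upTo _ k) (applyUpTo-period4 _ (λ _ → refl) k)) (cycle-false k)

∂-cycle : ∀ a b c d k → ∂ (cycle a b c d (suc k)) ≡ cycle (a xor b) (b xor c) (c xor d) (d xor a) k
∂-cycle a b c d zero    = refl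
∂-cycle a b c d (suc k) = cong ((a xor b) ∷_) (∂-cycle b c d a k)

triangleWeight-cycle : ∀ a b c d k → triangleWeight (cycle a b c d (suc k)) ≡
  weight (cycle a b c d (suc k)) + triangleWeight (cycle (a xor b) (b xor c) (c xor d) (d xor a) k)
triangleWeight-cycle a b c d k =
  trans (triangleWeight-∂ (cycle a b c d (suc k))) (cong (weight (cycle a b c d (suc k)) +_) (cong triangleWeight (∂-cycle a b c d k)))

record Growth (r d : ℕ) (w : ℕ → Word) : Set where
  constructor growing
  field
    grow : ∀ m → r ≤ m → triangleWeight (w (4 + m)) ≡ d + triangleWeight (w m)

open Growth

growth-cong : ∀ {r d w w′} → Growth r d w → (∀ m → triangleWeight (w m) ≡ triangleWeight (w′ m)) → Growth r d w′
growth-cong {d = d} (growing g) w≈w′ = growing λ m r≤m →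
  trans (sym (w≈w′ (4 + m))) (trans (g m r≤m) (cong (d +_) (w≈w′ m)))

growth-iterate : ∀ {r d w m} → Growth r d w → r ≤ m → ∀ p → triangleWeight (w (p * 4 + m)) ≡ p * d + triangleWeight (w m)
growth-iterate grows r≤m zero = refl
growth-iterate {d = d} {w} {m} grows r≤m (suc p) = begin
  triangleWeight (w (4 + (p * 4 + m)))    ≡⟨ grow grows (p * 4 + m) (≤-trans r≤m (m≤n+m m (p * 4))) ⟩
  d + triangleWeight (w (p * 4 + m))      ≡⟨ cong (d +_) (growth-iterate grows r≤m p) ⟩
  d + (p * d + triangleWeight (w m))      ≡⟨ +-assoc d (p * d) _ ⟨
  suc p * d + triangleWeight (w m)        ∎

cycle-false-growth : Growth 0 0 (cycle false false false false)
cycle-false-growth = growing λ m _ → trans (zero-row (4 + m)) (sym (zero-row m))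
  where
  zero-row : ∀ k → triangleWeight (cycle false false false false k) ≡ 0
  zero-row k = trans (cong triangleWeight (cycle-false k)) (triangleWeight-replicate-false k)

-- Adding a period to a 4-periodic word adds its weight to the first row and one period to every row below.
cycle-growth : ∀ {r d′} a b c d → Growth r d′ (cycle (a xor b) (b xor c) (c xor d) (d xor a)) →
               Growth (suc r) (weight (a ∷ b ∷ c ∷ d ∷ []) + d′) (cycle a b c d)
cycle-growth {r} {d′} a b c d grows = growing step
  where
  P : ℕ
  P = weight (a ∷ b ∷ c ∷ d ∷ [])
  ∂row : ℕ → Word
  ∂row = cycle (a xor b) (b xor c) (c xor d) (d xor a)
  step : ∀ m → suc r ≤ m → triangleWeight (cycle a b c d (4 + m)) ≡ (P + d′) + triangleWeight (cycle a b c d m)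
  step (suc m) (s≤s r≤m) = begin
    triangleWeight (cycle a b c d (5 + m))                         ≡⟨ triangleWeight-cycle a b c d (4 + m) ⟩
    weight (cycle a b c d (5 + m)) + triangleWeight (∂row (4 + m))
      ≡⟨ cong₂ _+_ (weight-++ (a ∷ b ∷ c ∷ d ∷ []) (cycle a b c d (suc m))) (grow grows m r≤m) ⟩
    (P + weight (cycle a b c d (suc m))) + (d′ + triangleWeight (∂row m))
      ≡⟨ interchange P _ d′ _ ⟩
    (P + d′) + (weight (cycle a b c d (suc m)) + triangleWeight (∂row m))
      ≡⟨ cong ((P + d′) +_) (triangleWeight-cycle a b c d m) ⟨
    (P + d′) + triangleWeight (cycle a b c d (suc m))              ∎

sparse : Bool → Bool → ℕ → Word
sparse a b m = a ∷ b ∷ true ∷ replicate (m ∸ 3) false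

triangleWeight-sparse : ∀ a b k → triangleWeight (sparse a b (4 + k)) ≡
  weight (a ∷ b ∷ true ∷ []) + triangleWeight (sparse (a xor b) (b xor true) (3 + k))
triangleWeight-sparse a b k = begin
  triangleWeight (sparse a b (4 + k))
    ≡⟨ triangleWeight-∂ (sparse a b (4 + k)) ⟩
  weight (sparse a b (4 + k)) + triangleWeight (∂ (sparse a b (4 + k)))
    ≡⟨ cong₂ _+_ weight-sparse (cong triangleWeight ∂-sparse) ⟩
  weight (a ∷ b ∷ true ∷ []) + triangleWeight (sparse (a xor b) (b xor true) (3 + k)) ∎
  where
  weight-sparse : weight (sparse a b (4 + k)) ≡ weight (a ∷ b ∷ true ∷ [])
  weight-sparse = begin
    weight ((a ∷ b ∷ true ∷ []) ++ replicate (suc k) false)           ≡⟨ weight-++ (a ∷ b ∷ true ∷ []) _ ⟩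
    weight (a ∷ b ∷ true ∷ []) + weight (replicate (suc k) false)   ≡⟨ cong (_ +_) (weight-replicate-false (suc k)) ⟩
    weight (a ∷ b ∷ true ∷ []) + 0                                  ≡⟨ +-identityʳ _ ⟩
    weight (a ∷ b ∷ true ∷ [])                                      ∎
  ∂-sparse : ∂ (sparse a b (4 + k)) ≡ sparse (a xor b) (b xor true) (3 + k)
  ∂-sparse = cong (λ z → (a xor b) ∷ (b xor true) ∷ true ∷ z) (∂-replicate-false k)

-- (a, b) ↦ (a xor b, not b) permutes Bool × Bool in a single 4-cycle whose weights sum to 8.
sparse-orbit : ∀ a b k → triangleWeight (sparse a b (7 + k)) ≡ 8 + triangleWeight (sparse a b (3 + k))
sparse-orbit a₀ b₀ k = around a₀ b₀
  where
  step : ∀ a b j {t} → triangleWeight (sparse (a xor b) (b xor true) (3 + j)) ≡ t →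
         triangleWeight (sparse a b (4 + j)) ≡ weight (a ∷ b ∷ true ∷ []) + t
  step a b j eq = trans (triangleWeight-sparse a b j) (cong (weight (a ∷ b ∷ true ∷ []) +_) eq)
  around : ∀ a b → triangleWeight (sparse a b (7 + k)) ≡ 8 + triangleWeight (sparse a b (3 + k))
  around false false = step false false (3 + k) (step false true (2 + k) (step true false (1 + k) (step true true k refl)))
  around false true  = step false true (3 + k) (step true false (2 + k) (step true true (1 + k) (step false false k refl)))
  around true  false = step true false (3 + k) (step true true (2 + k) (step false false (1 + k) (step false true k refl)))
  around true  true  = step true true (3 + k) (step false false (2 + k) (step false true (1 + k) (step true false k refl)))

sparse-growth : ∀ a b → Growth 3 8 (sparse a b)
sparse-growth a b = growing λ { (suc (suc (suc k))) (s≤s (s≤s (s≤s _))) → sparse-orbit a b k }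

reverse-++-zeros : ∀ xs k → reverse (xs ++ periodic false [] k) ≡ periodic false [] k ++ reverse xs
reverse-++-zeros xs k = trans (reverse-++ xs (periodic false [] k)) (cong (_++ reverse xs) (begin
  reverse (periodic false [] k)   ≡⟨ cong reverse (periodic-false k) ⟩
  reverse (replicate k false)     ≡⟨ reverse-replicate k false ⟩
  replicate k false               ≡⟨ periodic-false k ⟨
  periodic false [] k             ∎))

c₁-growth : Growth 3 8 c₁
c₁-growth = growth-cong
  (cycle-growth false false true true (cycle-growth false true false true (cycle-growth true true true true cycle-false-growth)))
  (λ m → cong triangleWeight (sym (periodic-cycle false false true true m)))

c₄-growth : Growth 3 8 c₄
c₄-growth = growth-cong
  (cycle-growth true true false false (cycle-growth false true false true (cycle-growth true true true true cycle-false-growth)))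
  (λ m → cong triangleWeight (sym (periodic-cycle true true false false m)))

c₂-growth : Growth 3 8 c₂
c₂-growth = growth-cong (sparse-growth true false)
  (λ m → cong (λ z → triangleWeight (true ∷ false ∷ true ∷ z)) (sym (periodic-false (m ∸ 3))))

c₅-growth : Growth 3 8 c₅
c₅-growth = growth-cong (sparse-growth false false)
  (λ m → cong (λ z → triangleWeight (false ∷ false ∷ true ∷ z)) (sym (periodic-false (m ∸ 3))))

c₃-growth : Growth 3 8 c₃
c₃-growth = growth-cong c₅-growth
  (λ m → trans (sym (triangleWeight-reverse (c₅ m))) (cong triangleWeight (reverse-++-zeros (false ∷ false ∷ true ∷ []) (m ∸ 3))))

c₆-growth : Growth 3 8 c₆
c₆-growth = growth-cong c₂-growth
  (λ m → trans (sym (triangleWeight-reverse (c₂ m))) (cong triangleWeight (reverse-++-zeros (true ∷ false ∷ true ∷ []) (m ∸ 3))))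

4≤n⇒n≡p*4+[4+r] : ∀ {n r} → 4 ≤ n → n % 4 ≡ r → ∃[ p ] n ≡ p * 4 + (4 + r)
4≤n⇒n≡p*4+[4+r] {n} 4≤n refl with n / 4 | m≡m%n+[m/n]*n n 4
... | zero  | n≡n%4+0 = ⊥-elim (<⇒≱ (m%n<n n 4) (subst (4 ≤_) (trans n≡n%4+0 (+-identityʳ (n % 4))) 4≤n))
... | suc p | n≡n%4+4+p*4 = p , (begin
  n                       ≡⟨ n≡n%4+4+p*4 ⟩
  n % 4 + (4 + p * 4)     ≡⟨ +-comm (n % 4) (4 + p * 4) ⟩
  4 + (p * 4 + n % 4)     ≡⟨ x∙yz≈y∙xz (p * 4) 4 (n % 4) ⟨
  p * 4 + (4 + n % 4)     ∎)

triangleWeight-closed-form : ∀ {w r n} k → Growth 3 8 w → 3 ≤ r → ∃[ p ] n ≡ p * 4 + r →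
                             triangleWeight (w r) + k ≡ 2 * r → triangleWeight (w n) ≡ 2 * n ∸ k
triangleWeight-closed-form {w} {r} k grows 3≤r (p , refl) base = begin
  triangleWeight (w (p * 4 + r))                   ≡⟨ m+n∸n≡m _ k ⟨
  triangleWeight (w (p * 4 + r)) + k ∸ k           ≡⟨ cong (λ t → t + k ∸ k) (growth-iterate grows 3≤r p) ⟩
  p * 8 + triangleWeight (w r) + k ∸ k             ≡⟨ cong (_∸ k) (+-assoc (p * 8) _ k) ⟩
  p * 8 + (triangleWeight (w r) + k) ∸ k           ≡⟨ cong (λ t → p * 8 + t ∸ k) base ⟩
  p * 8 + 2 * r ∸ k                                ≡⟨ cong (_∸ k) (double p r) ⟩
  2 * (p * 4 + r) ∸ k                              ∎
  where
  double : ∀ p r → p * 8 + 2 * r ≡ 2 * (p * 4 + r)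
  double = solve-∀

proposition6p4 : (n : ℕ) → 4 ≤ n → n % 2 ≡ 0 →
    (n % 4 ≡ 0 →
      (triangleWeight (c₁ n) ≡ 2 * n ∸ 3) × (triangleWeight (c₂ n) ≡ 2 * n ∸ 3) ×
      (triangleWeight (c₃ n) ≡ 2 * n ∸ 3) × (triangleWeight (c₄ n) ≡ 2 * n ∸ 3) ×
      (triangleWeight (c₅ n) ≡ 2 * n ∸ 3) × (triangleWeight (c₆ n) ≡ 2 * n ∸ 3))
    × (n % 4 ≡ 2 →
      (triangleWeight (c₁ n) ≡ 2 * n ∸ 4) × (triangleWeight (c₃ n) ≡ 2 * n ∸ 4) ×
      (triangleWeight (c₅ n) ≡ 2 * n ∸ 4) × (triangleWeight (c₂ n) ≡ 2 * n ∸ 2) ×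
      (triangleWeight (c₄ n) ≡ 2 * n ∸ 2) × (triangleWeight (c₆ n) ≡ 2 * n ∸ 2))
-- The parity hypothesis is implied by either case hypothesis.
proposition6p4 n 4≤n _ =
  (λ n%4≡0 → let n≡p*4+4 = 4≤n⇒n≡p*4+[4+r] 4≤n n%4≡0 in
     closed 3 c₁-growth n≡p*4+4 refl , closed 3 c₂-growth n≡p*4+4 refl ,
     closed 3 c₃-growth n≡p*4+4 refl , closed 3 c₄-growth n≡p*4+4 refl ,
     closed 3 c₅-growth n≡p*4+4 refl , closed 3 c₆-growth n≡p*4+4 refl) ,
  (λ n%4≡2 → let n≡p*4+6 = 4≤n⇒n≡p*4+[4+r] 4≤n n%4≡2 in
     closed 4 c₁-growth n≡p*4+6 refl , closed 4 c₃-growth n≡p*4+6 refl ,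
     closed 4 c₅-growth n≡p*4+6 refl , closed 2 c₂-growth n≡p*4+6 refl ,
     closed 2 c₄-growth n≡p*4+6 refl , closed 2 c₆-growth n≡p*4+6 refl)
  where
  closed : ∀ {w r} k → Growth 3 8 w → ∃[ p ] n ≡ p * 4 + (4 + r) →
           triangleWeight (w (4 + r)) + k ≡ 2 * (4 + r) → triangleWeight (w n) ≡ 2 * n ∸ k
  closed k grows = triangleWeight-closed-form k grows (m≤m+n 3 (suc _))
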